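{- Let $D=(\mathcal P,\mathcal B)$ be a symmetric incidence structure of type $(v,k,\lambda)$ with $\lambda\le\frac{k}{64\log k}$. Then there exists an equinumerous incidence-free pair $(X,Y)$ in $D$ of size at least $\frac{k\log k}{2\lambda}$.
   Context: An incidence structure $D=(\mathcal P,\mathcal B)$ ($\mathcal B$ a collection of subsets, called blocks, of $\mathcal P$) is a symmetric incidence structure (SIS) of type $(v,k,\lambda)$ if $|\mathcal P|=|\mathcal B|=v$, every block contains $k$ points, every point lies in $k$ blocks, $\lambda\ge1$ is the maximum number of blocks containing two distinct points, and $\lambda$ is also the maximum number of points contained in two distinct blocks. A pair $(X,Y)$, $X\subseteq\mathcal P$, $Y\subseteq\mathcal B$, is incidence-free if no point of $X$ lies in a block of $Y$; it is equinumerous if $|X|=|Y|$, and $|X|$ is its size. $\log$ is the natural logarithm. -}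

module Defs where

open import Data.Nat using (ℕ; zero; suc; _+_; _*_; _^_; _≤_)
open import Data.Nat using (_!)
open import Data.Fin using (Fin)
open import Data.Fin.Subset using (Subset; _∈_; _∉_; _∩_; ∣_∣)
open import Data.Fin.Subset.Properties using (_∈?_)
open import Data.Vec using (tabulate)
open import Data.Product using (Σ; _×_; ∃)
open import Relation.Binary.PropositionalEquality using (_≡_; _≢_)
open import Relation.Nullary using (does)

Blocks : ℕ → Set
Blocks v = Fin v → Subset v

blocksThrough : ∀ {v} → Blocks v → Fin v → Subset v
blocksThrough B p = tabulate (λ b → does (p ∈? B b))

pairDeg : ∀ {v} → Blocks v → Fin v → Fin v → ℕ
pairDeg B p q = ∣ blocksThrough B p ∩ blocksThrough B q ∣

blockMeet : ∀ {v} → Blocks v → Fin v → Fin v → ℕ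
blockMeet B b c = ∣ B b ∩ B c ∣

record IsSIS (v k lam : ℕ) (B : Blocks v) : Set where
  field
    lam≥1       : 1 ≤ lam
    blockSize   : ∀ b → ∣ B b ∣ ≡ k
    pointDeg    : ∀ p → ∣ blocksThrough B p ∣ ≡ k
    pairBound   : ∀ p q → p ≢ q → pairDeg B p q ≤ lam
    pairAttain  : Σ (Fin v) λ p → Σ (Fin v) λ q → p ≢ q × pairDeg B p q ≡ lam
    meetBound   : ∀ b c → b ≢ c → blockMeet B b c ≤ lam
    meetAttain  : Σ (Fin v) λ b → Σ (Fin v) λ c → b ≢ c × blockMeet B b c ≡ lam

IncidenceFree : ∀ {v} → Blocks v → Subset v → Subset v → Set
IncidenceFree B X Y = ∀ p b → p ∈ X → b ∈ Y → p ∉ B b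

-- expSum a m = m! * Σ_{j=0}^{m} a^j / j!  (a natural number)
expSum : ℕ → ℕ → ℕ
expSum a zero = 1
expSum a (suc m) = suc m * expSum a m + a ^ suc m

-- n ≤ e^a (real exponential), for naturals n, a:
-- holds iff some partial sum Σ_{j≤m} a^j/j! of the exponential series is ≥ n
-- (exact: for a = 0 all partial sums equal e^0 = 1; for a ≥ 1, e^a is
-- irrational, so n ≤ e^a iff n < e^a iff some partial sum reaches n).
LeExp : ℕ → ℕ → Set
LeExp n a = ∃ λ m → n * (m !) ≤ expSum a m

-- Greedy choice of points.  After t points have been chosen, let A be the set of blocks
-- missing all of them.  While at least (n+1)k points are still unchosen, averaging the
-- A-degrees of the unchosen points gives one lying on at most |A|/(n+1) blocks of A; adding
-- it keeps |A| ≥ v (n/(n+1))^t.  So once s (1+1/n)^s ≤ v, the s chosen points and s of the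
-- surviving blocks form an incidence-free pair.
--
-- Counting the pairs (q, b) with p, q ∈ b for a fixed point p gives k(k−1) ≤ λ(v−1).
-- Take n = ⌊4v/5k⌋ and s maximal with s (1+1/n)^s ≤ v: failure at s+1 forces
-- (1+1/n)^(3s) ≥ k², and as 4λn ≥ 3k this gives e^(2λs) ≥ (1+1/n)^(2λns) ≥ k^k.  The
-- hypothesis k^(64λ) ≤ e^k, through e^k ≤ (2k+2) k^k/k!, forces k ≥ 240 and 64λ ≤ k, which
-- is what these estimates need.

module Submission where

open import Defs

open import Data.Bool using (Bool; true; false; _∧_; _∨_; not; T)
open import Data.Bool.Properties using (not-injective; ∧-idem; ∧-conicalˡ; ∧-conicalʳ) renaming (_≟_ to _≟ᵇ_)
open import Data.Fin using (Fin; zero; suc; punchIn; toℕ; fromℕ<)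
open import Data.Fin.Properties using (any?; all?; punchInᵢ≢i; toℕ-fromℕ<) renaming (_≟_ to _≟ᶠ_)
open import Data.Fin.Subset using (Subset; _∈_; _∉_; _∩_; ∣_∣; ⊥)
open import Data.Fin.Subset.Properties using (_∈?_; ∉⊥; ∣⊥∣≡0)
open import Data.Nat using (ℕ; zero; suc; _+_; _*_; _^_; _!; _≤_; _<_; _≤?_; _<ᵇ_; _∸_; z≤n; s≤s; NonZero; >-nonZero)
open import Data.Nat.DivMod using (_/_; _%_; m≡m%n+[m/n]*n; m%n<n; m/n*n≤m)
open import Data.Nat.Properties
open import Data.Nat.Solver using (module +-*-Solver)
open import Data.Product using (Σ; ∃; _×_; _,_; proj₁; proj₂)
open import Data.Sum using (inj₁; inj₂)
open import Data.Vec using ([]; _∷_; tabulate)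
import Data.Vec.Functional as Vector
open import Data.Vec.Properties using (lookup∘tabulate; []=⇒lookup)
open import Function using (_∘_)
open import Relation.Binary.PropositionalEquality
open import Relation.Nullary using (does; yes; no; ¬_; contradiction)
open import Relation.Nullary.Decidable using (_×-dec_; dec-true; toWitness; T?)
open import Relation.Unary using (Decidable)

open import Algebra.Properties.CommutativeMonoid.Sum +-0-commutativeMonoid
  using (sum; sum-syntax; sum-cong-≗; sum-remove; ∑-comm; ∑-distrib-+)
open import Algebra.Properties.CommutativeSemigroup *-commutativeSemigroup
  using (interchange; x∙yz≈y∙xz; x∙yz≈y∙zx; x∙yz≈z∙xy; xy∙z≈xz∙y; xy∙z≈zx∙y)
open import Algebra.Properties.Semiring.Sum +-*-semiring using (*-distribˡ-sum; *-distribʳ-sum)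

open +-*-Solver

∑-const : ∀ n c → ∑[ i < n ] c ≡ n * c
∑-const zero    c = refl
∑-const (suc n) c = cong (c +_) (∑-const n c)

∑-mono-≤ : ∀ {n} {f g : Fin n → ℕ} → (∀ i → f i ≤ g i) → sum f ≤ sum g
∑-mono-≤ {zero}  f≤g = z≤n
∑-mono-≤ {suc n} f≤g = +-mono-≤ (f≤g zero) (∑-mono-≤ (f≤g ∘ suc))

∑+c≤f[i]+n*c : ∀ {n} (f : Fin n → ℕ) (i : Fin n) c → (∀ j → j ≢ i → f j ≤ c) →
               sum f + c ≤ f i + n * c
∑+c≤f[i]+n*c {suc n} f i c f≤c = begin
  sum f + c                           ≡⟨ cong (_+ c) (sum-remove {i = i} f) ⟩
  f i + sum (f ∘ punchIn i) + c       ≤⟨ +-monoˡ-≤ c (+-monoʳ-≤ (f i) rest≤) ⟩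
  f i + n * c + c                     ≡⟨ +-assoc (f i) (n * c) c ⟩
  f i + (n * c + c)                   ≡⟨ cong (f i +_) (+-comm (n * c) c) ⟩
  f i + suc n * c                     ∎
  where
  open ≤-Reasoning
  rest≤ : sum (f ∘ punchIn i) ≤ n * c
  rest≤ = ≤-trans (∑-mono-≤ (λ j → f≤c (punchIn i j) (punchInᵢ≢i i j))) (≤-reflexive (∑-const n c))

𝟙 : Bool → ℕ
𝟙 true  = 1
𝟙 false = 0

𝟙-∧ : ∀ a b → 𝟙 (a ∧ b) ≡ 𝟙 a * 𝟙 b
𝟙-∧ true  b = sym (+-identityʳ (𝟙 b))
𝟙-∧ false b = refl

𝟙-∨-disjoint : ∀ a b → a ∧ b ≡ false → 𝟙 (a ∨ b) ≡ 𝟙 a + 𝟙 b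
𝟙-∨-disjoint true  false _ = refl
𝟙-∨-disjoint false b     _ = refl

𝟙-split : ∀ a b → 𝟙 a ≡ 𝟙 (a ∧ not b) + 𝟙 (a ∧ b)
𝟙-split true  true  = refl
𝟙-split true  false = refl
𝟙-split false b     = refl

𝟙-not : ∀ a → 𝟙 (not a) + 𝟙 a ≡ 1
𝟙-not true  = refl
𝟙-not false = refl

𝟙*≤ : ∀ a x → 𝟙 a * x ≤ x
𝟙*≤ true  x = ≤-reflexive (+-identityʳ x)
𝟙*≤ false x = z≤n

count : ∀ {n} → (Fin n → Bool) → ℕ
count {n} P = ∑[ i < n ] 𝟙 (P i)

count-cong : ∀ {n} {P Q : Fin n → Bool} → (∀ i → P i ≡ Q i) → count P ≡ count Q
count-cong P≗Q = sum-cong-≗ (cong 𝟙 ∘ P≗Q)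

count-∅ : ∀ n → count {n} (λ _ → false) ≡ 0
count-∅ n = trans (∑-const n 0) (*-zeroʳ n)

count-all : ∀ n → count {n} (λ _ → true) ≡ n
count-all n = trans (∑-const n 1) (*-identityʳ n)

count-split : ∀ {n} (P Q : Fin n → Bool) →
              count P ≡ count (λ i → P i ∧ not (Q i)) + count (λ i → P i ∧ Q i)
count-split P Q = trans (sum-cong-≗ (λ i → 𝟙-split (P i) (Q i)))
                        (∑-distrib-+ (λ i → 𝟙 (P i ∧ not (Q i))) (λ i → 𝟙 (P i ∧ Q i)))

count-not : ∀ {n} (P : Fin n → Bool) → count (not ∘ P) + count P ≡ n
count-not {n} P = begin
  count (not ∘ P) + count P          ≡⟨ ∑-distrib-+ (𝟙 ∘ not ∘ P) (𝟙 ∘ P) ⟨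
  ∑[ i < n ] (𝟙 (not (P i)) + 𝟙 (P i)) ≡⟨ sum-cong-≗ (𝟙-not ∘ P) ⟩
  ∑[ i < n ] 1                        ≡⟨ count-all n ⟩
  n                                   ∎
  where open ≡-Reasoning

count-singleton : ∀ {n} (i : Fin n) → count (λ j → does (j ≟ᶠ i)) ≡ 1
count-singleton {suc n} zero    = cong suc (count-∅ n)
count-singleton {suc n} (suc i) = trans (count-cong same) (count-singleton i)
  where
  same : ∀ j → does (suc j ≟ᶠ suc i) ≡ does (j ≟ᶠ i)
  same j with j ≟ᶠ i
  ... | yes _ = refl
  ... | no  _ = refl

count-insert : ∀ {n} (P : Fin n → Bool) i → P i ≡ false →
               count (λ j → P j ∨ does (j ≟ᶠ i)) ≡ suc (count P)
count-insert {n} P i Pi≡false = begin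
  count (λ j → P j ∨ does (j ≟ᶠ i))                     ≡⟨ sum-cong-≗ (λ j → 𝟙-∨-disjoint (P j) _ (disjoint j)) ⟩
  ∑[ j < n ] (𝟙 (P j) + 𝟙 (does (j ≟ᶠ i)))            ≡⟨ ∑-distrib-+ (𝟙 ∘ P) _ ⟩
  count P + count (λ j → does (j ≟ᶠ i))                 ≡⟨ cong (count P +_) (count-singleton i) ⟩
  count P + 1                                           ≡⟨ +-comm (count P) 1 ⟩
  suc (count P)                                         ∎
  where
  open ≡-Reasoning
  disjoint : ∀ j → P j ∧ does (j ≟ᶠ i) ≡ false
  disjoint j with P j in Pj | j ≟ᶠ i
  ... | false | _        = refl
  ... | true  | no  _    = refl
  ... | true  | yes refl = trans (sym Pj) Pi≡false

count-shrink : ∀ {n} (P : Fin n → Bool) s → s ≤ count P →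
               ∃ λ Q → count Q ≡ s × (∀ i → Q i ≡ true → P i ≡ true)
count-shrink {zero}  P zero _ = P , refl , (λ ())
count-shrink {suc n} P s s≤ with P zero in P0
count-shrink {suc n} P zero    _ | true = (λ _ → false) , count-∅ (suc n) , (λ _ ())
count-shrink {suc n} P (suc s) (s≤s s≤) | true with count-shrink (P ∘ suc) s s≤
... | Q , #Q , Q⊆P = true Vector.∷ Q , cong suc #Q , λ { zero _ → P0 ; (suc i) → Q⊆P i }
count-shrink {suc n} P s s≤ | false with count-shrink (P ∘ suc) s s≤
... | Q , #Q , Q⊆P = false Vector.∷ Q , #Q , λ { zero () ; (suc i) → Q⊆P i }

∃-≤-average : ∀ {n} (P : Fin n → Bool) (d : Fin n → ℕ) → 0 < count P →
              ∃ λ i → P i ≡ true × count P * d i ≤ ∑[ j < n ] (𝟙 (P j) * d j)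
∃-≤-average {n} P d 0<c with any? (λ i → (P i ≟ᵇ true) ×-dec (count P * d i ≤? ∑[ j < n ] (𝟙 (P j) * d j)))
... | yes found = found
... | no none = contradiction total<total (<-irrefl refl)
  where
  c total : ℕ
  c     = count P
  total = ∑[ j < n ] (𝟙 (P j) * d j)
  instance
    _ : NonZero c
    _ = >-nonZero 0<c
  above : ∀ j → 𝟙 (P j) * suc total ≤ 𝟙 (P j) * (c * d j)
  above j with P j in Pj
  ... | false = z≤n
  ... | true  = +-monoˡ-≤ 0 (≰⇒> (λ le → none (j , Pj , le)))
  total<total : c * total < c * total
  total<total = begin-strict
    c * total                            <⟨ *-monoʳ-< c ≤-refl ⟩
    c * suc total                        ≡⟨ *-distribʳ-sum (suc total) (𝟙 ∘ P) ⟩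
    ∑[ j < n ] (𝟙 (P j) * suc total)     ≤⟨ ∑-mono-≤ above ⟩
    ∑[ j < n ] (𝟙 (P j) * (c * d j))     ≡⟨ sum-cong-≗ (λ j → x∙yz≈y∙xz (𝟙 (P j)) c (d j)) ⟩
    ∑[ j < n ] (c * (𝟙 (P j) * d j))     ≡⟨ *-distribˡ-sum c (λ j → 𝟙 (P j) * d j) ⟨
    c * total                            ∎
    where open ≤-Reasoning

∣p∣≡count∈ : ∀ {n} (p : Subset n) → ∣ p ∣ ≡ count (λ i → does (i ∈? p))
∣p∣≡count∈ []          = refl
∣p∣≡count∈ (true  ∷ p) = cong suc (∣p∣≡count∈ p)
∣p∣≡count∈ (false ∷ p) = ∣p∣≡count∈ p

∣tabulate∣≡count : ∀ {n} (P : Fin n → Bool) → ∣ tabulate P ∣ ≡ count P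
∣tabulate∣≡count {zero}  P = refl
∣tabulate∣≡count {suc n} P with P zero
... | true  = cong suc (∣tabulate∣≡count (P ∘ suc))
... | false = ∣tabulate∣≡count (P ∘ suc)

tabulate-∩ : ∀ {n} (P Q : Fin n → Bool) → tabulate P ∩ tabulate Q ≡ tabulate (λ i → P i ∧ Q i)
tabulate-∩ {zero}  P Q = refl
tabulate-∩ {suc n} P Q = cong (P zero ∧ Q zero ∷_) (tabulate-∩ (P ∘ suc) (Q ∘ suc))

∈-tabulate⁻ : ∀ {n} (P : Fin n → Bool) {i} → i ∈ tabulate P → P i ≡ true
∈-tabulate⁻ P {i} i∈P = trans (sym (lookup∘tabulate P i)) ([]=⇒lookup i∈P)

module Incidence {v w} (B : Fin w → Subset v) where

  incident : Fin v → Fin w → Bool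
  incident p b = does (p ∈? B b)

  degree : (Fin w → Bool) → Fin v → ℕ
  degree A p = count (λ b → A b ∧ incident p b)

  Avoids : (Fin v → Bool) → (Fin w → Bool) → Set
  Avoids X A = ∀ p b → X p ≡ true → A b ≡ true → incident p b ≡ false

  ∑-degree≡∑∣B∣ : ∀ A → ∑[ p < v ] degree A p ≡ ∑[ b < w ] (𝟙 (A b) * ∣ B b ∣)
  ∑-degree≡∑∣B∣ A = begin
    ∑[ p < v ] ∑[ b < w ] 𝟙 (A b ∧ incident p b)        ≡⟨ ∑-comm (λ p b → 𝟙 (A b ∧ incident p b)) ⟩
    ∑[ b < w ] ∑[ p < v ] 𝟙 (A b ∧ incident p b)        ≡⟨ sum-cong-≗ (λ b → sum-cong-≗ (λ p → 𝟙-∧ (A b) (incident p b))) ⟩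
    ∑[ b < w ] ∑[ p < v ] (𝟙 (A b) * 𝟙 (incident p b))  ≡⟨ sum-cong-≗ (λ b → *-distribˡ-sum (𝟙 (A b)) (λ p → 𝟙 (incident p b))) ⟨
    ∑[ b < w ] (𝟙 (A b) * count (λ p → incident p b))   ≡⟨ sum-cong-≗ (λ b → cong (𝟙 (A b) *_) (∣p∣≡count∈ (B b))) ⟨
    ∑[ b < w ] (𝟙 (A b) * ∣ B b ∣)                       ∎
    where open ≡-Reasoning

  ∑-degree≤k*count : ∀ {k} → (∀ b → ∣ B b ∣ ≤ k) → ∀ A → ∑[ p < v ] degree A p ≤ k * count A
  ∑-degree≤k*count {k} ∣B∣≤k A = begin
    ∑[ p < v ] degree A p                ≡⟨ ∑-degree≡∑∣B∣ A ⟩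
    ∑[ b < w ] (𝟙 (A b) * ∣ B b ∣)       ≤⟨ ∑-mono-≤ (λ b → *-monoʳ-≤ (𝟙 (A b)) (∣B∣≤k b)) ⟩
    ∑[ b < w ] (𝟙 (A b) * k)             ≡⟨ *-distribʳ-sum k (𝟙 ∘ A) ⟨
    count A * k                          ≡⟨ *-comm (count A) k ⟩
    k * count A                          ∎
    where open ≤-Reasoning

  avoids-insert : ∀ X A p → Avoids X A →
                  Avoids (λ q → X q ∨ does (q ≟ᶠ p)) (λ b → A b ∧ not (incident p b))
  avoids-insert X A p X⊥A q b X′q A′b with X q in Xq | q ≟ᶠ p
  ... | true  | _        = X⊥A q b Xq (∧-conicalˡ (A b) _ A′b)
  ... | false | yes refl = not-injective (∧-conicalʳ (A b) _ A′b)

  n*count≤[1+n]*count-removed : ∀ n A p → suc n * degree A p ≤ count A →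
                                 n * count A ≤ suc n * count (λ b → A b ∧ not (incident p b))
  n*count≤[1+n]*count-removed n A p low = +-cancelˡ-≤ y _ _ (begin
    suc n * y                       ≡⟨ cong (suc n *_) (count-split A (incident p)) ⟩
    suc n * (y′ + degree A p)       ≡⟨ *-distribˡ-+ (suc n) y′ (degree A p) ⟩
    suc n * y′ + suc n * degree A p ≤⟨ +-monoʳ-≤ (suc n * y′) low ⟩
    suc n * y′ + y                  ≡⟨ +-comm (suc n * y′) y ⟩
    y + suc n * y′                  ∎)
    where
    open ≤-Reasoning
    y y′ : ℕ
    y  = count A
    y′ = count (λ b → A b ∧ not (incident p b))

  module _ {k} (0<k : 0 < k) (∣B∣≤k : ∀ b → ∣ B b ∣ ≤ k) where

    ∃-low-degree : ∀ n (X : Fin v → Bool) A → suc n * k + count X ≤ v →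
                   ∃ λ p → X p ≡ false × suc n * degree A p ≤ count A
    ∃-low-degree n X A room =
      let p , X̅p , c*dp≤ = ∃-≤-average (not ∘ X) (degree A) 0<c
      in  p , not-injective X̅p , *-cancelˡ-≤ k (begin
        k * (suc n * degree A p)                 ≡⟨ x∙yz≈y∙xz k (suc n) (degree A p) ⟩
        suc n * (k * degree A p)                 ≡⟨ *-assoc (suc n) k (degree A p) ⟨
        suc n * k * degree A p                   ≤⟨ *-monoˡ-≤ (degree A p) [n+1]k≤c ⟩
        c * degree A p                           ≤⟨ c*dp≤ ⟩
        ∑[ q < v ] (𝟙 (not (X q)) * degree A q)  ≤⟨ ∑-mono-≤ (λ q → 𝟙*≤ (not (X q)) (degree A q)) ⟩
        ∑[ q < v ] degree A q                    ≤⟨ ∑-degree≤k*count ∣B∣≤k A ⟩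
        k * count A                              ∎)
      where
      open ≤-Reasoning
      instance
        _ : NonZero k
        _ = >-nonZero 0<k
      c : ℕ
      c = count (not ∘ X)
      [n+1]k≤c : suc n * k ≤ c
      [n+1]k≤c = +-cancelʳ-≤ (count X) _ _ (≤-trans room (≤-reflexive (sym (count-not X))))
      0<c : 0 < c
      0<c = ≤-trans (≤-trans 0<k (m≤m+n k (n * k))) [n+1]k≤c

    greedy : ∀ n t → suc n * k + t ≤ v →
             ∃ λ X → ∃ λ A → count X ≡ t × Avoids X A × n ^ t * w ≤ suc n ^ t * count A
    greedy n zero room =
      (λ _ → false) , (λ _ → true) , count-∅ v , (λ _ _ ()) , ≤-reflexive (cong (1 *_) (sym (count-all w)))
    greedy n (suc t) room =
      let X , A , #X , X⊥A , bound = greedy n t room′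
          p , Xp≡false , low = ∃-low-degree n X A (subst (λ x → suc n * k + x ≤ v) (sym #X) room′)
          y  : ℕ
          y  = count A
          y′ : ℕ
          y′ = count (λ b → A b ∧ not (incident p b))
      in  (λ q → X q ∨ does (q ≟ᶠ p)) , (λ b → A b ∧ not (incident p b)) ,
          trans (count-insert X p Xp≡false) (cong suc #X) , avoids-insert X A p X⊥A , (begin
            n * n ^ t * w               ≡⟨ *-assoc n (n ^ t) w ⟩
            n * (n ^ t * w)             ≤⟨ *-monoʳ-≤ n bound ⟩
            n * (suc n ^ t * y)         ≡⟨ x∙yz≈y∙xz n (suc n ^ t) y ⟩
            suc n ^ t * (n * y)         ≤⟨ *-monoʳ-≤ (suc n ^ t) (n*count≤[1+n]*count-removed n A p low) ⟩
            suc n ^ t * (suc n * y′)    ≡⟨ x∙yz≈y∙xz (suc n ^ t) (suc n) y′ ⟩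
            suc n * (suc n ^ t * y′)    ≡⟨ *-assoc (suc n) (suc n ^ t) y′ ⟨
            suc n * suc n ^ t * y′      ∎)
      where
      open ≤-Reasoning
      room′ : suc n * k + t ≤ v
      room′ = ≤-trans (+-monoʳ-≤ (suc n * k) (n≤1+n t)) room

    incidence-free-pair : ∀ n s → suc n * k + s ≤ v → s * suc n ^ s ≤ w * n ^ s →
      Σ (Subset v) λ X → Σ (Subset w) λ Y →
        (∀ p b → p ∈ X → b ∈ Y → p ∉ B b) × ∣ X ∣ ≡ s × ∣ Y ∣ ≡ s
    incidence-free-pair n s room few =
      let X , A , #X , X⊥A , bound = greedy n s room
          Y , #Y , Y⊆A = count-shrink A s (*-cancelʳ-≤ s (count A) (suc n ^ s) (begin
            s * suc n ^ s                ≤⟨ few ⟩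
            w * n ^ s                    ≡⟨ *-comm w (n ^ s) ⟩
            n ^ s * w                    ≤⟨ bound ⟩
            suc n ^ s * count A          ≡⟨ *-comm (suc n ^ s) (count A) ⟩
            count A * suc n ^ s          ∎))
      in  tabulate X , tabulate Y ,
          (λ p b p∈X b∈Y p∈Bb → contradiction
            (trans (sym (dec-true (p ∈? B b) p∈Bb)) (X⊥A p b (∈-tabulate⁻ X p∈X) (Y⊆A b (∈-tabulate⁻ Y b∈Y))))
            λ ()) ,
          trans (∣tabulate∣≡count X) #X , trans (∣tabulate∣≡count Y) #Y
      where
      open ≤-Reasoning
      instance
        _ : NonZero (suc n ^ s)
        _ = m^n≢0 (suc n) s

module _ {v k lam} {B : Blocks v} (sis : IsSIS v k lam B) where
  open IsSIS sis
  open Incidence B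

  pairDeg≡degree : ∀ p q → pairDeg B p q ≡ degree (incident p) q
  pairDeg≡degree p q = trans (cong ∣_∣ (tabulate-∩ (incident p) (incident q))) (∣tabulate∣≡count (λ b → incident p b ∧ incident q b))

  k*k+λ≤k+v*λ : Fin v → k * k + lam ≤ k + v * lam
  k*k+λ≤k+v*λ p = begin
    k * k + lam                                 ≡⟨ cong (_+ lam) ∑pairDeg≡k*k ⟨
    ∑[ q < v ] pairDeg B p q + lam              ≤⟨ ∑+c≤f[i]+n*c (pairDeg B p) p lam (λ q q≢p → pairBound p q (q≢p ∘ sym)) ⟩
    pairDeg B p p + v * lam                     ≡⟨ cong (_+ v * lam) pairDeg[p,p]≡k ⟩
    k + v * lam                                 ∎
    where
    open ≤-Reasoning
    deg[p]≡k : count (incident p) ≡ k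
    deg[p]≡k = trans (sym (∣tabulate∣≡count (incident p))) (pointDeg p)
    pairDeg[p,p]≡k : pairDeg B p p ≡ k
    pairDeg[p,p]≡k = trans (pairDeg≡degree p p) (trans (count-cong (λ b → ∧-idem (incident p b))) deg[p]≡k)
    ∑pairDeg≡k*k : ∑[ q < v ] pairDeg B p q ≡ k * k
    ∑pairDeg≡k*k = begin-equality
      ∑[ q < v ] pairDeg B p q                      ≡⟨ sum-cong-≗ (pairDeg≡degree p) ⟩
      ∑[ q < v ] degree (incident p) q              ≡⟨ ∑-degree≡∑∣B∣ (incident p) ⟩
      ∑[ b < v ] (𝟙 (incident p b) * ∣ B b ∣)       ≡⟨ sum-cong-≗ (λ b → cong (𝟙 (incident p b) *_) (blockSize b)) ⟩
      ∑[ b < v ] (𝟙 (incident p b) * k)             ≡⟨ *-distribʳ-sum k (𝟙 ∘ incident p) ⟨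
      count (incident p) * k                        ≡⟨ cong (_* k) deg[p]≡k ⟩
      k * k                                         ∎

^-distrib-* : ∀ a b m → (a * b) ^ m ≡ a ^ m * b ^ m
^-distrib-* a b zero    = refl
^-distrib-* a b (suc m) = begin
  a * b * (a * b) ^ m     ≡⟨ cong (a * b *_) (^-distrib-* a b m) ⟩
  a * b * (a ^ m * b ^ m) ≡⟨ interchange a b (a ^ m) (b ^ m) ⟩
  a * a ^ m * (b * b ^ m) ∎
  where open ≡-Reasoning

bernoulli : ∀ a m → a ^ suc m + suc m * a ^ m ≤ suc a ^ suc m
bernoulli a zero    = ≤-reflexive (solve 1 (λ a → a :* con 1 :+ con 1 :* con 1 := (con 1 :+ a) :* con 1) refl a)
bernoulli a (suc m) = begin
  a * (a * a ^ m) + suc (suc m) * (a * a ^ m)                     ≤⟨ m≤m+n _ (suc m * a ^ m) ⟩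
  a * (a * a ^ m) + suc (suc m) * (a * a ^ m) + suc m * a ^ m     ≡⟨ solve 3 (λ a m x → a :* (a :* x) :+ (con 2 :+ m) :* (a :* x) :+ (con 1 :+ m) :* x
                                                                        := (con 1 :+ a) :* (a :* x :+ (con 1 :+ m) :* x)) refl a m (a ^ m) ⟩
  suc a * (a * a ^ m + suc m * a ^ m)                             ≤⟨ *-monoʳ-≤ (suc a) (bernoulli a m) ⟩
  suc a * suc a ^ suc m                                           ∎
  where open ≤-Reasoning

n≤n! : ∀ n → n ≤ n !
n≤n! zero    = z≤n
n≤n! (suc n) = m≤m*n (suc n) (n !) {{n !≢0}}

∀-range : ∀ (P : ℕ → Set) a n → (∀ (i : Fin n) → P (a + toℕ i)) → ∀ m → a ≤ m → m < a + n → P m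
∀-range P a n P[a+i] m a≤m m<a+n = subst P a+i≡m (P[a+i] i)
  where
  i : Fin n
  i = fromℕ< (+-cancelˡ-< a (m ∸ a) n (subst (_< a + n) (sym (m+[n∸m]≡n a≤m)) m<a+n))
  a+i≡m : a + toℕ i ≡ m
  a+i≡m = trans (cong (a +_) (toℕ-fromℕ< _)) (m+[n∸m]≡n a≤m)

m<[1+m/n]*n : ∀ m n .{{_ : NonZero n}} → m < suc (m / n) * n
m<[1+m/n]*n m n = begin-strict
  m                    ≡⟨ m≡m%n+[m/n]*n m n ⟩
  m % n + m / n * n    <⟨ +-monoˡ-< (m / n * n) (m%n<n m n) ⟩
  n + m / n * n        ∎
  where open ≤-Reasoning

^-cancelˡ-≤ : ∀ n .{{_ : NonZero n}} {x y} → x ^ n ≤ y ^ n → x ≤ y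
^-cancelˡ-≤ n xⁿ≤yⁿ = ≮⇒≥ (λ y<x → <⇒≱ (^-monoˡ-< n y<x) xⁿ≤yⁿ)

∃-boundary : ∀ (P : ℕ → Set) → Decidable P → P 0 → ∀ m → ¬ P m → ∃ λ s → P s × ¬ P (suc s)
∃-boundary P P? P0 zero    ¬Pm = contradiction P0 ¬Pm
∃-boundary P P? P0 (suc m) ¬P[1+m] with P? m
... | yes Pm  = m , Pm , ¬P[1+m]
... | no  ¬Pm = ∃-boundary P P? P0 m ¬Pm

n^s*[n+s]≤n*[1+n]^s : ∀ n s → n ^ s * (n + s) ≤ n * suc n ^ s
n^s*[n+s]≤n*[1+n]^s n zero    = ≤-reflexive (solve 1 (λ n → con 1 :* (n :+ con 0) := n :* con 1) refl n)
n^s*[n+s]≤n*[1+n]^s n (suc s) = begin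
  n * n ^ s * (n + suc s)
    ≡⟨ solve 3 (λ n x s → n :* x :* (n :+ (con 1 :+ s)) := n :* (n :* x :+ (con 1 :+ s) :* x)) refl n (n ^ s) s ⟩
  n * (n ^ suc s + suc s * n ^ s)  ≤⟨ *-monoʳ-≤ n (bernoulli n s) ⟩
  n * suc n ^ suc s                ∎
  where open ≤-Reasoning

2^q*n^[r+q*n]≤[1+n]^[r+q*n] : ∀ n .{{_ : NonZero n}} q r → 2 ^ q * n ^ (r + q * n) ≤ suc n ^ (r + q * n)
2^q*n^[r+q*n]≤[1+n]^[r+q*n] n zero r = begin
  1 * n ^ (r + 0)       ≡⟨ *-identityˡ _ ⟩
  n ^ (r + 0)           ≤⟨ ^-monoˡ-≤ (r + 0) (n≤1+n n) ⟩
  suc n ^ (r + 0)       ∎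
  where open ≤-Reasoning
2^q*n^[r+q*n]≤[1+n]^[r+q*n] n (suc q) r = begin
  2 * 2 ^ q * n ^ (r + (n + q * n)) ≡⟨ cong (λ i → 2 * 2 ^ q * n ^ i) r+[n+qn]≡R+n ⟩
  2 * 2 ^ q * n ^ (R + n)           ≡⟨ cong (2 * 2 ^ q *_) (^-distribˡ-+-* n R n) ⟩
  2 * 2 ^ q * (n ^ R * n ^ n)       ≡⟨ solve 3 (λ x y z → con 2 :* x :* (y :* z) := x :* y :* (con 2 :* z)) refl (2 ^ q) (n ^ R) (n ^ n) ⟩
  2 ^ q * n ^ R * (2 * n ^ n)       ≤⟨ *-mono-≤ (2^q*n^[r+q*n]≤[1+n]^[r+q*n] n q r) 2*n^n≤[1+n]^n ⟩
  suc n ^ R * suc n ^ n             ≡⟨ ^-distribˡ-+-* (suc n) R n ⟨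
  suc n ^ (R + n)                   ≡⟨ cong (suc n ^_) r+[n+qn]≡R+n ⟨
  suc n ^ (r + (n + q * n))         ∎
  where
  open ≤-Reasoning
  R : ℕ
  R = r + q * n
  r+[n+qn]≡R+n : r + (n + q * n) ≡ R + n
  r+[n+qn]≡R+n = solve 3 (λ r n q → r :+ (n :+ q :* n) := r :+ q :* n :+ n) refl r n q
  2*n^n≤[1+n]^n : 2 * n ^ n ≤ suc n ^ n
  2*n^n≤[1+n]^n = *-cancelˡ-≤ n (begin
    n * (2 * n ^ n)   ≡⟨ solve 2 (λ n x → n :* (con 2 :* x) := x :* (n :+ n)) refl n (n ^ n) ⟩
    n ^ n * (n + n)   ≤⟨ n^s*[n+s]≤n*[1+n]^s n n ⟩
    n * suc n ^ n     ∎)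

[1+n]^j*10^j≤n^j*11^j : ∀ {n} → 10 ≤ n → ∀ j → suc n ^ j * 10 ^ j ≤ n ^ j * 11 ^ j
[1+n]^j*10^j≤n^j*11^j {n} 10≤n j = begin
  suc n ^ j * 10 ^ j   ≡⟨ ^-distrib-* (suc n) 10 j ⟨
  (suc n * 10) ^ j     ≤⟨ ^-monoˡ-≤ j [1+n]*10≤n*11 ⟩
  (n * 11) ^ j         ≡⟨ ^-distrib-* n 11 j ⟩
  n ^ j * 11 ^ j       ∎
  where
  open ≤-Reasoning
  [1+n]*10≤n*11 : suc n * 10 ≤ n * 11
  [1+n]*10≤n*11 = begin
    suc n * 10         ≡⟨ solve 1 (λ n → (con 1 :+ n) :* con 10 := n :* con 10 :+ con 10) refl n ⟩
    n * 10 + 10        ≤⟨ +-monoʳ-≤ (n * 10) 10≤n ⟩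
    n * 10 + n         ≡⟨ solve 1 (λ n → n :* con 10 :+ n := n :* con 11) refl n ⟩
    n * 11             ∎

[1+q]^3≤q*2^q : ∀ q → 7 ≤ q → suc q ^ 3 ≤ q * 2 ^ q
[1+q]^3≤q*2^q q 7≤q = subst (λ q → suc q ^ 3 ≤ q * 2 ^ q) (m∸n+n≡m 7≤q) (from7 (q ∸ 7))
  where
  from7 : ∀ d → suc (d + 7) ^ 3 ≤ (d + 7) * 2 ^ (d + 7)
  from7 zero    = ≤ᵇ⇒≤ 512 896 _
  from7 (suc d) = begin
    suc (suc Q) ^ 3                               ≤⟨ m≤m+n _ (d ^ 3 + 21 * d ^ 2 + 141 * d + 295) ⟩
    suc (suc Q) ^ 3 + (d ^ 3 + 21 * d ^ 2 + 141 * d + 295)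
      ≡⟨ solve 1 (λ d → (con 2 :+ (d :+ con 7)) :^ 3 :+ (d :^ 3 :+ con 21 :* d :^ 2 :+ con 141 :* d :+ con 295)
                        := con 2 :* (con 1 :+ (d :+ con 7)) :^ 3) refl d ⟩
    2 * suc Q ^ 3                                 ≤⟨ *-monoʳ-≤ 2 (from7 d) ⟩
    2 * (Q * 2 ^ Q)                               ≡⟨ x∙yz≈y∙xz 2 Q (2 ^ Q) ⟩
    Q * 2 ^ suc Q                                 ≤⟨ *-monoˡ-≤ (2 ^ suc Q) (n≤1+n Q) ⟩
    suc Q * 2 ^ suc Q                             ∎
    where open ≤-Reasoning
          Q : ℕ
          Q = d + 7

c²b³≤a³⇒cᵏbᵉ≤aᵉ : ∀ {a b c} k e t → c ^ 2 * b ^ 3 ≤ a ^ 3 → b ≤ a → 3 * k + t ≡ 2 * e → c ^ k * b ^ e ≤ a ^ e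
c²b³≤a³⇒cᵏbᵉ≤aᵉ {a} {b} {c} k e t c²b³≤a³ b≤a 3k+t≡2e = ^-cancelˡ-≤ 2 (begin
  (c ^ k * b ^ e) ^ 2             ≡⟨ ^-distrib-* (c ^ k) (b ^ e) 2 ⟩
  (c ^ k) ^ 2 * (b ^ e) ^ 2       ≡⟨ cong₂ _*_ (swap-exponents c k 2) (^-*-assoc b e 2) ⟩
  (c ^ 2) ^ k * b ^ (e * 2)       ≡⟨ cong ((c ^ 2) ^ k *_) (split b) ⟩
  (c ^ 2) ^ k * ((b ^ 3) ^ k * b ^ t) ≡⟨ *-assoc ((c ^ 2) ^ k) ((b ^ 3) ^ k) (b ^ t) ⟨
  (c ^ 2) ^ k * (b ^ 3) ^ k * b ^ t   ≡⟨ cong (_* b ^ t) (^-distrib-* (c ^ 2) (b ^ 3) k) ⟨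
  (c ^ 2 * b ^ 3) ^ k * b ^ t     ≤⟨ *-mono-≤ (^-monoˡ-≤ k c²b³≤a³) (^-monoˡ-≤ t b≤a) ⟩
  (a ^ 3) ^ k * a ^ t             ≡⟨ split a ⟨
  a ^ (e * 2)                     ≡⟨ ^-*-assoc a e 2 ⟨
  (a ^ e) ^ 2                     ∎)
  where
  open ≤-Reasoning
  swap-exponents : ∀ x i j → (x ^ i) ^ j ≡ (x ^ j) ^ i
  swap-exponents x i j = trans (^-*-assoc x i j) (trans (cong (x ^_) (*-comm i j)) (sym (^-*-assoc x j i)))
  split : ∀ x → x ^ (e * 2) ≡ (x ^ 3) ^ k * x ^ t
  split x = begin-equality
    x ^ (e * 2)          ≡⟨ cong (x ^_) (trans (*-comm e 2) (sym 3k+t≡2e)) ⟩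
    x ^ (3 * k + t)      ≡⟨ ^-distribˡ-+-* x (3 * k) t ⟩
    x ^ (3 * k) * x ^ t  ≡⟨ cong (_* x ^ t) (^-*-assoc x 3 k) ⟨
    (x ^ 3) ^ k * x ^ t  ∎

-- (q+1)(n+1)/n ≤ (5/4) k^(1/3): directly for q ≤ 6, and otherwise from (q+1)³ ≤ q 2^q
-- together with q n 2^q ≤ v < (5/4) k (n+1).
[1+q]^3*[1+n]^3*64≤125*k*n^3 : ∀ q n k v → 10 ≤ n → 240 ≤ k → q * n * 2 ^ q ≤ v → 4 * v < suc n * (5 * k) →
                                suc q ^ 3 * suc n ^ 3 * 64 ≤ 125 * k * n ^ 3
[1+q]^3*[1+n]^3*64≤125*k*n^3 q n k v 10≤n 240≤k q*n*2^q≤v 4v<[1+n]*5k with q ≤? 6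
... | yes q≤6 = *-cancelʳ-≤ (suc q ^ 3 * suc n ^ 3 * 64) (125 * k * n ^ 3) 1000 (begin
  suc q ^ 3 * suc n ^ 3 * 64 * 1000     ≤⟨ *-monoˡ-≤ 1000 (*-monoˡ-≤ 64 (*-monoˡ-≤ (suc n ^ 3) (^-monoˡ-≤ 3 (s≤s q≤6)))) ⟩
  343 * suc n ^ 3 * 64 * 1000
    ≡⟨ solve 1 (λ x → con 343 :* x :* con 64 :* con 1000 := con 21952 :* (x :* con 1000)) refl (suc n ^ 3) ⟩
  21952 * (suc n ^ 3 * 1000)            ≤⟨ *-monoʳ-≤ 21952 ([1+n]^j*10^j≤n^j*11^j 10≤n 3) ⟩
  21952 * (n ^ 3 * 1331)                ≡⟨ solve 1 (λ x → con 21952 :* (x :* con 1331) := con 29218112 :* x) refl (n ^ 3) ⟩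
  29218112 * n ^ 3                      ≤⟨ *-monoˡ-≤ (n ^ 3) (≤ᵇ⇒≤ 29218112 (125 * 240 * 1000) _) ⟩
  125 * 240 * 1000 * n ^ 3              ≤⟨ *-monoˡ-≤ (n ^ 3) (*-monoˡ-≤ 1000 (*-monoʳ-≤ 125 240≤k)) ⟩
  125 * k * 1000 * n ^ 3                ≡⟨ xy∙z≈xz∙y (125 * k) 1000 (n ^ 3) ⟩
  125 * k * n ^ 3 * 1000                ∎)
  where open ≤-Reasoning
... | no  q≰6 = <⇒≤ (*-cancelʳ-< (suc n * 50000) (suc q ^ 3 * suc n ^ 3 * 64) (125 * k * n ^ 3) (begin-strict
  suc q ^ 3 * suc n ^ 3 * 64 * (suc n * 50000)
    ≤⟨ *-monoˡ-≤ (suc n * 50000) (*-monoˡ-≤ 64 (*-monoˡ-≤ (suc n ^ 3) ([1+q]^3≤q*2^q q (≰⇒> q≰6)))) ⟩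
  q * 2 ^ q * suc n ^ 3 * 64 * (suc n * 50000)
    ≡⟨ solve 3 (λ Q x m → Q :* x :* m :^ 3 :* con 64 :* (m :* con 50000) := Q :* x :* (m :^ 4 :* con 10000) :* con 320)
             refl q (2 ^ q) (suc n) ⟩
  q * 2 ^ q * (suc n ^ 4 * 10000) * 320
    ≤⟨ *-monoˡ-≤ 320 (*-monoʳ-≤ (q * 2 ^ q) ([1+n]^j*10^j≤n^j*11^j 10≤n 4)) ⟩
  q * 2 ^ q * (n ^ 4 * 14641) * 320
    ≡⟨ solve 3 (λ Q x m → Q :* x :* (m :^ 4 :* con 14641) :* con 320 := m :^ 3 :* (Q :* m :* x) :* con 4685120)
             refl q (2 ^ q) n ⟩
  n ^ 3 * (q * n * 2 ^ q) * 4685120     ≤⟨ *-monoʳ-≤ (n ^ 3 * (q * n * 2 ^ q)) (≤ᵇ⇒≤ 4685120 5000000 _) ⟩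
  n ^ 3 * (q * n * 2 ^ q) * 5000000     ≤⟨ *-monoˡ-≤ 5000000 (*-monoʳ-≤ (n ^ 3) q*n*2^q≤v) ⟩
  n ^ 3 * v * 5000000
    ≡⟨ solve 2 (λ x v → x :* v :* con 5000000 := x :* (con 4 :* v) :* con 1250000) refl (n ^ 3) v ⟩
  n ^ 3 * (4 * v) * 1250000             <⟨ *-monoˡ-< 1250000 (*-monoʳ-< (n ^ 3) {{m^n≢0 n 3 {{>-nonZero (≤-trans (s≤s z≤n) 10≤n)}}}} 4v<[1+n]*5k) ⟩
  n ^ 3 * (suc n * (5 * k)) * 1250000
    ≡⟨ solve 3 (λ x m k → x :* (m :* (con 5 :* k)) :* con 1250000 := con 125 :* k :* x :* (m :* con 50000))
             refl (n ^ 3) (suc n) k ⟩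
  125 * k * n ^ 3 * (suc n * 50000)     ∎))
  where open ≤-Reasoning

-- scaledExpSum n a N = N! · Σ_{j ≤ N} a^j n^(N−j) / j!
scaledExpSum : ℕ → ℕ → ℕ → ℕ
scaledExpSum n a zero    = 1
scaledExpSum n a (suc N) = suc N * n * scaledExpSum n a N + a ^ suc N

scaledExpSum-suc : ∀ n a N → suc n * suc N * scaledExpSum n a N + a ^ suc N ≤ scaledExpSum n (suc a) (suc N)
scaledExpSum-suc n a zero    = ≤-reflexive (solve 2 (λ n a → (con 1 :+ n) :* con 1 :* con 1 :+ a :* con 1 := con 1 :* n :* con 1 :+ (con 1 :+ a) :* con 1) refl n a)
scaledExpSum-suc n a (suc N) = begin
  suc n * suc (suc N) * (suc N * n * E + P) + a * P
    ≡⟨ solve 5 (λ n a N E P → (con 1 :+ n) :* (con 2 :+ N) :* ((con 1 :+ N) :* n :* E :+ P) :+ a :* P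
                           := (con 2 :+ N) :* n :* ((con 1 :+ n) :* (con 1 :+ N) :* E :+ P) :+ (a :* P :+ (con 2 :+ N) :* P))
                 refl n a N E P ⟩
  suc (suc N) * n * (suc n * suc N * E + P) + (a * P + suc (suc N) * P)
    ≤⟨ +-mono-≤ (*-monoʳ-≤ (suc (suc N) * n) (scaledExpSum-suc n a N)) (bernoulli a (suc N)) ⟩
  suc (suc N) * n * scaledExpSum n (suc a) (suc N) + suc a ^ suc (suc N) ∎
  where
  open ≤-Reasoning
  E P : ℕ
  E = scaledExpSum n a N
  P = a ^ suc N

[1+n]^N*N!≤scaledExpSum : ∀ n N → suc n ^ N * N ! ≤ scaledExpSum n N N
[1+n]^N*N!≤scaledExpSum n zero    = ≤-refl
[1+n]^N*N!≤scaledExpSum n (suc N) = begin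
  suc n * suc n ^ N * (suc N * N !)
    ≡⟨ solve 4 (λ n x N f → (con 1 :+ n) :* x :* ((con 1 :+ N) :* f) := (con 1 :+ n) :* (con 1 :+ N) :* (x :* f))
             refl n (suc n ^ N) N (N !) ⟩
  suc n * suc N * (suc n ^ N * N !)             ≤⟨ *-monoʳ-≤ (suc n * suc N) ([1+n]^N*N!≤scaledExpSum n N) ⟩
  suc n * suc N * scaledExpSum n N N            ≤⟨ m≤m+n _ (N ^ suc N) ⟩
  suc n * suc N * scaledExpSum n N N + N ^ suc N ≤⟨ scaledExpSum-suc n N N ⟩
  scaledExpSum n (suc N) (suc N)                ∎
  where open ≤-Reasoning

scaledExpSum-*ˡ : ∀ n y N → scaledExpSum n (n * y) N ≡ n ^ N * expSum y N
scaledExpSum-*ˡ n y zero    = refl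
scaledExpSum-*ˡ n y (suc N) = begin
  suc N * n * scaledExpSum n (n * y) N + (n * y) ^ suc N
    ≡⟨ cong₂ (λ u w → suc N * n * u + w) (scaledExpSum-*ˡ n y N) (^-distrib-* n y (suc N)) ⟩
  suc N * n * (n ^ N * expSum y N) + n * n ^ N * (y * y ^ N)
    ≡⟨ solve 6 (λ N n x e y z → (con 1 :+ N) :* n :* (x :* e) :+ n :* x :* (y :* z) := n :* x :* ((con 1 :+ N) :* e :+ y :* z))
             refl N n (n ^ N) (expSum y N) y (y ^ N) ⟩
  n * n ^ N * (suc N * expSum y N + y * y ^ N)
    ∎
  where open ≡-Reasoning

-- (1 + 1/n)^(ny) ≤ e^y, comparing the binomial expansion with the exponential series.
LeExp-intro : ∀ A n y → .{{NonZero n}} → A * n ^ (n * y) ≤ suc n ^ (n * y) → LeExp A y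
LeExp-intro A n y A*nᴺ≤[n+1]ᴺ = N , *-cancelʳ-≤ (A * N !) (expSum y N) (n ^ N) (begin
  A * N ! * n ^ N              ≡⟨ xy∙z≈xz∙y A (N !) (n ^ N) ⟩
  A * n ^ N * N !              ≤⟨ *-monoˡ-≤ (N !) A*nᴺ≤[n+1]ᴺ ⟩
  suc n ^ N * N !              ≤⟨ [1+n]^N*N!≤scaledExpSum n N ⟩
  scaledExpSum n N N           ≡⟨ scaledExpSum-*ˡ n y N ⟩
  n ^ N * expSum y N           ≡⟨ *-comm (n ^ N) (expSum y N) ⟩
  expSum y N * n ^ N           ∎)
  where
  N : ℕ
  N = n * y
  open ≤-Reasoning
  instance
    _ : NonZero (n ^ N)
    _ = m^n≢0 n N

[d+j]!≤j!*[d+j]^d : ∀ j d → (d + j) ! ≤ j ! * (d + j) ^ d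
[d+j]!≤j!*[d+j]^d j zero    = ≤-reflexive (sym (*-identityʳ (j !)))
[d+j]!≤j!*[d+j]^d j (suc d) = begin
  suc (d + j) * (d + j) !                ≤⟨ *-monoʳ-≤ (suc (d + j)) ([d+j]!≤j!*[d+j]^d j d) ⟩
  suc (d + j) * (j ! * (d + j) ^ d)      ≤⟨ *-monoʳ-≤ (suc (d + j)) (*-monoʳ-≤ (j !) (^-monoˡ-≤ d (n≤1+n (d + j)))) ⟩
  suc (d + j) * (j ! * suc (d + j) ^ d)  ≡⟨ x∙yz≈y∙xz (suc (d + j)) (j !) (suc (d + j) ^ d) ⟩
  j ! * (suc (d + j) * suc (d + j) ^ d)  ∎
  where open ≤-Reasoning

k!*k^d≤[d+k]! : ∀ k d → k ! * k ^ d ≤ (d + k) !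
k!*k^d≤[d+k]! k zero    = ≤-reflexive (*-identityʳ (k !))
k!*k^d≤[d+k]! k (suc d) = begin
  k ! * (k * k ^ d)   ≡⟨ x∙yz≈y∙xz (k !) k (k ^ d) ⟩
  k * (k ! * k ^ d)   ≤⟨ *-mono-≤ (m≤n+m k (suc d)) (k!*k^d≤[d+k]! k d) ⟩
  (suc d + k) * (d + k) ! ∎
  where open ≤-Reasoning

k^j*k!≤j!*k^k : ∀ k j → k ^ j * k ! ≤ j ! * k ^ k
k^j*k!≤j!*k^k k j with ≤-total j k
... | inj₁ j≤k = let d , j+d≡k = m≤n⇒∃[o]m+o≡n j≤k in
  subst (λ k → k ^ j * k ! ≤ j ! * k ^ k) (trans (+-comm d j) j+d≡k) (j≤k-case d)
  where
  j≤k-case : ∀ d → (d + j) ^ j * (d + j) ! ≤ j ! * (d + j) ^ (d + j)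
  j≤k-case d = begin
    K ^ j * K !           ≤⟨ *-monoʳ-≤ (K ^ j) ([d+j]!≤j!*[d+j]^d j d) ⟩
    K ^ j * (j ! * K ^ d) ≡⟨ x∙yz≈y∙zx (K ^ j) (j !) (K ^ d) ⟩
    j ! * (K ^ d * K ^ j) ≡⟨ cong (j ! *_) (^-distribˡ-+-* K d j) ⟨
    j ! * K ^ (d + j)     ∎
    where open ≤-Reasoning
          K : ℕ
          K = d + j
... | inj₂ k≤j = let d , k+d≡j = m≤n⇒∃[o]m+o≡n k≤j in
  subst (λ j → k ^ j * k ! ≤ j ! * k ^ k) (trans (+-comm d k) k+d≡j) (k≤j-case d)
  where
  k≤j-case : ∀ d → k ^ (d + k) * k ! ≤ (d + k) ! * k ^ k
  k≤j-case d = begin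
    k ^ (d + k) * k !     ≡⟨ cong (_* k !) (^-distribˡ-+-* k d k) ⟩
    k ^ d * k ^ k * k !   ≡⟨ xy∙z≈zx∙y (k ^ d) (k ^ k) (k !) ⟩
    k ! * k ^ d * k ^ k   ≤⟨ *-monoˡ-≤ (k ^ k) (k!*k^d≤[d+k]! k d) ⟩
    (d + k) ! * k ^ k     ∎
    where open ≤-Reasoning

expSum*k!≤[m+1]*m!*k^k : ∀ k m → expSum k m * k ! ≤ suc m * m ! * k ^ k
expSum*k!≤[m+1]*m!*k^k k zero    = k^j*k!≤j!*k^k k 0
expSum*k!≤[m+1]*m!*k^k k (suc m) = begin
  (suc m * E + k ^ suc m) * k !                        ≡⟨ *-distribʳ-+ (k !) (suc m * E) (k ^ suc m) ⟩
  suc m * E * k ! + k ^ suc m * k !                    ≡⟨ cong (_+ k ^ suc m * k !) (*-assoc (suc m) E (k !)) ⟩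
  suc m * (E * k !) + k ^ suc m * k !                  ≤⟨ +-mono-≤ (*-monoʳ-≤ (suc m) (expSum*k!≤[m+1]*m!*k^k k m))
                                                                   (k^j*k!≤j!*k^k k (suc m)) ⟩
  suc m * (suc m * m ! * k ^ k) + suc m * m ! * k ^ k
    ≡⟨ solve 3 (λ a f x → a :* (a :* f :* x) :+ a :* f :* x := (con 1 :+ a) :* (a :* f) :* x) refl (suc m) (m !) (k ^ k) ⟩
  suc (suc m) * (suc m * m !) * k ^ k                  ∎
  where open ≤-Reasoning
        E : ℕ
        E = expSum k m

expSum-mono : ∀ k m d → expSum k m * (d + m) ! ≤ m ! * expSum k (d + m)
expSum-mono k m zero    = ≤-reflexive (*-comm (expSum k m) (m !))
expSum-mono k m (suc d) = begin
  E * (suc (d + m) * (d + m) !)                           ≡⟨ x∙yz≈y∙xz E (suc (d + m)) ((d + m) !) ⟩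
  suc (d + m) * (E * (d + m) !)                           ≤⟨ *-monoʳ-≤ (suc (d + m)) (expSum-mono k m d) ⟩
  suc (d + m) * (m ! * E′)                                ≡⟨ x∙yz≈y∙xz (suc (d + m)) (m !) E′ ⟩
  m ! * (suc (d + m) * E′)                                ≤⟨ m≤m+n _ _ ⟩
  m ! * (suc (d + m) * E′) + m ! * k ^ suc (d + m)        ≡⟨ *-distribˡ-+ (m !) _ _ ⟨
  m ! * (suc (d + m) * E′ + k ^ suc (d + m))              ∎
  where open ≤-Reasoning
        E E′ : ℕ
        E  = expSum k m
        E′ = expSum k (d + m)

expSum-tail : ∀ k d → let M = k + k in
              (expSum k (d + M) + k ^ (d + M)) * M ! ≤ (d + M) ! * (expSum k M + k ^ M)
expSum-tail k zero    = ≤-reflexive (*-comm (expSum k (k + k) + k ^ (k + k)) ((k + k) !))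
expSum-tail k (suc d) = begin
  (suc m * E + k * x + k * x) * M !  ≤⟨ *-monoˡ-≤ (M !) next≤ ⟩
  suc m * (E + x) * M !              ≡⟨ *-assoc (suc m) (E + x) (M !) ⟩
  suc m * ((E + x) * M !)            ≤⟨ *-monoʳ-≤ (suc m) (expSum-tail k d) ⟩
  suc m * (m ! * R)                  ≡⟨ *-assoc (suc m) (m !) R ⟨
  suc m * m ! * R                    ∎
  where
  open ≤-Reasoning
  M m E x R : ℕ
  M = k + k
  m = d + M
  E = expSum k m
  x = k ^ m
  R = expSum k M + k ^ M
  next≤ : suc m * E + k * x + k * x ≤ suc m * (E + x)
  next≤ = begin
    suc m * E + k * x + k * x      ≡⟨ +-assoc (suc m * E) (k * x) (k * x) ⟩
    suc m * E + (k * x + k * x)    ≡⟨ cong (suc m * E +_) (*-distribʳ-+ x k k) ⟨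
    suc m * E + M * x              ≤⟨ +-monoʳ-≤ (suc m * E) (*-monoˡ-≤ x (≤-trans (m≤n+m M d) (n≤1+n m))) ⟩
    suc m * E + suc m * x          ≡⟨ *-distribˡ-+ (suc m) E x ⟨
    suc m * (E + x)                ∎

expSum*[2k]!≤ : ∀ k m → expSum k m * (k + k) ! ≤ m ! * (expSum k (k + k) + k ^ (k + k))
expSum*[2k]!≤ k m with ≤-total m (k + k)
... | inj₁ m≤M = let d , m+d≡M = m≤n⇒∃[o]m+o≡n m≤M
                     d+m≡M = trans (+-comm d m) m+d≡M in begin
  expSum k m * M !               ≡⟨ cong (λ i → expSum k m * i !) d+m≡M ⟨
  expSum k m * (d + m) !         ≤⟨ expSum-mono k m d ⟩
  m ! * expSum k (d + m)         ≡⟨ cong (λ i → m ! * expSum k i) d+m≡M ⟩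
  m ! * expSum k M               ≤⟨ *-monoʳ-≤ (m !) (m≤m+n (expSum k M) (k ^ M)) ⟩
  m ! * (expSum k M + k ^ M)     ∎
  where open ≤-Reasoning
        M : ℕ
        M = k + k
... | inj₂ M≤m = let d , M+d≡m = m≤n⇒∃[o]m+o≡n M≤m in
  subst (λ m → expSum k m * M ! ≤ m ! * (expSum k M + k ^ M)) (trans (+-comm d M) M+d≡m) (begin
    expSum k (d + M) * M !                 ≤⟨ *-monoˡ-≤ (M !) (m≤m+n (expSum k (d + M)) (k ^ (d + M))) ⟩
    (expSum k (d + M) + k ^ (d + M)) * M ! ≤⟨ expSum-tail k d ⟩
    (d + M) ! * (expSum k M + k ^ M)       ∎)
  where open ≤-Reasoning
        M : ℕ
        M = k + k

-- e^k ≤ (2k+2) k^k/k!: no term k^j/j! exceeds k^k/k!, and from j = 2k on the partial sum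
-- plus its last term decreases.
LeExp⇒*!≤ : ∀ {c k} → LeExp c k → c * k ! ≤ (k + k + 2) * k ^ k
LeExp⇒*!≤ {c} {k} (m , c*m!≤expSum) = *-cancelʳ-≤ (c * k !) ((M + 2) * k ^ k) (M !) (begin
  c * k ! * M !                        ≡⟨ xy∙z≈xz∙y c (k !) (M !) ⟩
  c * M ! * k !                        ≤⟨ *-monoˡ-≤ (k !) c*M!≤ ⟩
  (expSum k M + k ^ M) * k !           ≡⟨ *-distribʳ-+ (k !) (expSum k M) (k ^ M) ⟩
  expSum k M * k ! + k ^ M * k !       ≤⟨ +-mono-≤ (expSum*k!≤[m+1]*m!*k^k k M) (k^j*k!≤j!*k^k k M) ⟩
  suc M * M ! * k ^ k + M ! * k ^ k
    ≡⟨ solve 3 (λ m f x → (con 1 :+ m) :* f :* x :+ f :* x := (m :+ con 2) :* x :* f) refl M (M !) (k ^ k) ⟩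
  (M + 2) * k ^ k * M !                ∎)
  where
  open ≤-Reasoning
  M : ℕ
  M = k + k
  instance
    _ : NonZero (M !)
    _ = M !≢0
    _ : NonZero (m !)
    _ = m !≢0
  c*M!≤ : c * M ! ≤ expSum k M + k ^ M
  c*M!≤ = *-cancelʳ-≤ (c * M !) (expSum k M + k ^ M) (m !) (begin
    c * M ! * m !                      ≡⟨ xy∙z≈xz∙y c (M !) (m !) ⟩
    c * m ! * M !                      ≤⟨ *-monoˡ-≤ (M !) c*m!≤expSum ⟩
    expSum k m * M !                   ≤⟨ expSum*[2k]!≤ k m ⟩
    m ! * (expSum k M + k ^ M)         ≡⟨ *-comm (m !) _ ⟩
    (expSum k M + k ^ M) * m !         ∎)

[2k+2]*k^k<ᵇk^64*k! : ℕ → Bool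
[2k+2]*k^k<ᵇk^64*k! k = (k + k + 2) * k ^ k <ᵇ k ^ 64 * k !

-- Decided by evaluation; the statement is kept in this form so that the type checker
-- never has to unfold the powers for a symbolic k.
[2k+2]*k^k<k^64*k!-below-240 : ∀ k → 2 ≤ k → k < 240 → (k + k + 2) * k ^ k < k ^ 64 * k !
[2k+2]*k^k<k^64*k!-below-240 k 2≤k k<240 =
  <ᵇ⇒< ((k + k + 2) * k ^ k) (k ^ 64 * k !) (∀-range (T ∘ [2k+2]*k^k<ᵇk^64*k!) 2 238 checked k 2≤k k<240)
  where
  checked : ∀ (i : Fin 238) → T ([2k+2]*k^k<ᵇk^64*k! (2 + toℕ i))
  checked = toWitness {a? = all? (λ i → T? ([2k+2]*k^k<ᵇk^64*k! (2 + toℕ i)))} _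

module _ {k lam} (1≤lam : 1 ≤ lam) (k^[64λ]≤eᵏ : LeExp (k ^ (64 * lam)) k) where

  240≤k : 2 ≤ k → 240 ≤ k
  240≤k 2≤k = ≮⇒≥ λ k<240 → <⇒≱ ([2k+2]*k^k<k^64*k!-below-240 k 2≤k k<240) k^64*k!≤
    where
    instance
      _ : NonZero k
      _ = >-nonZero (≤-trans (s≤s z≤n) 2≤k)
    k^64*k!≤ : k ^ 64 * k ! ≤ (k + k + 2) * k ^ k
    k^64*k!≤ = ≤-trans (*-monoˡ-≤ (k !) (^-monoʳ-≤ k (*-monoʳ-≤ 64 1≤lam))) (LeExp⇒*!≤ {k ^ (64 * lam)} k^[64λ]≤eᵏ)

  64λ≤k : 3 ≤ k → 64 * lam ≤ k
  64λ≤k 3≤k = ≮⇒≥ λ k<64λ → <⇒≱ 2k+2<k*k (≤-trans (*-monoʳ-≤ k (n≤n! k)) (k*k!≤2k+2 k<64λ))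
    where
    instance
      _ : NonZero k
      _ = >-nonZero (≤-trans (s≤s z≤n) 3≤k)
      _ : NonZero (k ^ k)
      _ = m^n≢0 k k
    k*k!≤2k+2 : k < 64 * lam → k * k ! ≤ k + k + 2
    k*k!≤2k+2 k<64λ = *-cancelʳ-≤ (k * k !) (k + k + 2) (k ^ k) (begin
      k * k ! * k ^ k               ≡⟨ xy∙z≈zx∙y k (k !) (k ^ k) ⟩
      k ^ k * k * k !               ≡⟨ cong (_* k !) (*-comm (k ^ k) k) ⟩
      k ^ suc k * k !               ≤⟨ *-monoˡ-≤ (k !) (^-monoʳ-≤ k k<64λ) ⟩
      k ^ (64 * lam) * k !          ≤⟨ LeExp⇒*!≤ {k ^ (64 * lam)} k^[64λ]≤eᵏ ⟩
      (k + k + 2) * k ^ k           ∎)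
      where open ≤-Reasoning
    2k+2<k*k : k + k + 2 < k * k
    2k+2<k*k = begin-strict
      k + k + 2      <⟨ +-monoʳ-< (k + k) 3≤k ⟩
      k + k + k      ≡⟨ solve 1 (λ k → k :+ k :+ k := con 3 :* k) refl k ⟩
      3 * k          ≤⟨ *-monoˡ-≤ k 3≤k ⟩
      k * k          ∎
      where open ≤-Reasoning

-- n ≈ 4v/5k leaves room for the greedy choice, and s is the largest size its bound allows;
-- the failure at s + 1 is what yields k² (n^s)³ ≤ ((n+1)^s)³.
module Parameters {v k lam} (1≤lam : 1 ≤ lam) (240≤k : 240 ≤ k) (64λ≤k : 64 * lam ≤ k)
                  (k*k+λ≤k+v*λ : k * k + lam ≤ k + v * lam) where

  private instance
    k≢0 : NonZero k
    k≢0 = >-nonZero (≤-trans (s≤s z≤n) 240≤k)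
    λ≢0 : NonZero lam
    λ≢0 = >-nonZero 1≤lam
    5k≢0 : NonZero (5 * k)
    5k≢0 = m*n≢0 5 k

  13k≤v : 13 * k ≤ v
  13k≤v = *-cancelˡ-≤ lam (+-cancelˡ-≤ k _ _ (begin
    k + lam * (13 * k)               ≤⟨ +-monoˡ-≤ (lam * (13 * k)) (≤-trans (m≤n*m k 51) (m≤n*m (51 * k) lam)) ⟩
    lam * (51 * k) + lam * (13 * k)
      ≡⟨ solve 2 (λ l k → l :* (con 51 :* k) :+ l :* (con 13 :* k) := con 64 :* l :* k) refl lam k ⟩
    64 * lam * k               ≤⟨ *-monoˡ-≤ k 64λ≤k ⟩
    k * k                      ≤⟨ m≤m+n (k * k) lam ⟩
    k * k + lam                ≤⟨ k*k+λ≤k+v*λ ⟩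
    k + v * lam                ≡⟨ cong (k +_) (*-comm v lam) ⟩
    k + lam * v                ∎))
    where open ≤-Reasoning

  n : ℕ
  n = 4 * v / (5 * k)

  n*5k≤4v : n * (5 * k) ≤ 4 * v
  n*5k≤4v = m/n*n≤m (4 * v) (5 * k)

  4v<[1+n]*5k : 4 * v < suc n * (5 * k)
  4v<[1+n]*5k = m<[1+m/n]*n (4 * v) (5 * k)

  10≤n : 10 ≤ n
  10≤n = ≮⇒≥ λ n<10 → <-irrefl refl (begin-strict
    52 * k               ≡⟨ *-assoc 4 13 k ⟩
    4 * (13 * k)         ≤⟨ *-monoʳ-≤ 4 13k≤v ⟩
    4 * v                <⟨ 4v<[1+n]*5k ⟩
    suc n * (5 * k)      ≤⟨ *-monoˡ-≤ (5 * k) n<10 ⟩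
    10 * (5 * k)         ≡⟨ *-assoc 10 5 k ⟨
    50 * k               ≤⟨ *-monoˡ-≤ k (≤ᵇ⇒≤ 50 52 _) ⟩
    52 * k               ∎)
    where open ≤-Reasoning

  instance
    n≢0 : NonZero n
    n≢0 = >-nonZero (≤-trans (s≤s z≤n) 10≤n)

  4k<4+5λ[1+n] : 4 * k < 4 + 5 * lam * suc n
  4k<4+5λ[1+n] = *-cancelʳ-< k (4 * k) (4 + 5 * lam * suc n) (begin-strict
    4 * k * k                            ≡⟨ *-assoc 4 k k ⟩
    4 * (k * k)                          ≤⟨ *-monoʳ-≤ 4 (m≤m+n (k * k) lam) ⟩
    4 * (k * k + lam)                    ≤⟨ *-monoʳ-≤ 4 k*k+λ≤k+v*λ ⟩
    4 * (k + v * lam)                    ≡⟨ solve 3 (λ k v l → con 4 :* (k :+ v :* l) := con 4 :* k :+ l :* (con 4 :* v)) refl k v lam ⟩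
    4 * k + lam * (4 * v)                <⟨ +-monoʳ-< (4 * k) (*-monoʳ-< lam 4v<[1+n]*5k) ⟩
    4 * k + lam * (suc n * (5 * k))
      ≡⟨ solve 3 (λ k l n → con 4 :* k :+ l :* ((con 1 :+ n) :* (con 5 :* k)) := (con 4 :+ con 5 :* l :* (con 1 :+ n)) :* k)
               refl k lam n ⟩
    (4 + 5 * lam * suc n) * k            ∎)
    where open ≤-Reasoning

  12+20λ≤k : 12 + 20 * lam ≤ k
  12+20λ≤k = *-cancelˡ-≤ 64 (begin
    64 * (12 + 20 * lam)       ≡⟨ solve 1 (λ l → con 64 :* (con 12 :+ con 20 :* l) := con 768 :+ con 20 :* (con 64 :* l)) refl lam ⟩
    768 + 20 * (64 * lam)      ≤⟨ +-monoʳ-≤ 768 (*-monoʳ-≤ 20 64λ≤k) ⟩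
    768 + 20 * k               ≤⟨ +-monoˡ-≤ (20 * k) (≤-trans (≤ᵇ⇒≤ 768 (44 * 240) _) (*-monoʳ-≤ 44 240≤k)) ⟩
    44 * k + 20 * k            ≡⟨ *-distribʳ-+ k 44 20 ⟨
    64 * k                     ∎)
    where open ≤-Reasoning

  3k≤4λn : 3 * k ≤ 4 * lam * n
  3k≤4λn = *-cancelˡ-≤ 5 (+-cancelˡ-≤ k _ _ (begin
    k + 5 * (3 * k)                     ≡⟨ solve 1 (λ k → k :+ con 5 :* (con 3 :* k) := con 4 :* (con 4 :* k)) refl k ⟩
    4 * (4 * k)                         ≤⟨ *-monoʳ-≤ 4 (≤-pred 4k<4+5λ[1+n]) ⟩
    4 * (3 + 5 * lam * suc n)
      ≡⟨ solve 2 (λ l n → con 4 :* (con 3 :+ con 5 :* l :* (con 1 :+ n)) := (con 12 :+ con 20 :* l) :+ con 5 :* (con 4 :* l :* n))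
               refl lam n ⟩
    (12 + 20 * lam) + 5 * (4 * lam * n) ≤⟨ +-monoˡ-≤ (5 * (4 * lam * n)) 12+20λ≤k ⟩
    k + 5 * (4 * lam * n)               ∎))
    where open ≤-Reasoning

  Few : ℕ → Set
  Few s = s * suc n ^ s ≤ v * n ^ s

  ¬few[1+v] : ¬ Few (suc v)
  ¬few[1+v] few = <⇒≱ (begin-strict
    v * n ^ suc v         <⟨ *-monoˡ-< (n ^ suc v) {{m^n≢0 n (suc v)}} (n<1+n v) ⟩
    suc v * n ^ suc v     ≤⟨ *-monoʳ-≤ (suc v) (^-monoˡ-≤ (suc v) (n≤1+n n)) ⟩
    suc v * suc n ^ suc v ∎) few
    where open ≤-Reasoning

  boundary : ∃ λ s → Few s × ¬ Few (suc s)
  boundary = ∃-boundary Few (λ s → s * suc n ^ s ≤? v * n ^ s) z≤n (suc v) ¬few[1+v]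

  s : ℕ
  s = proj₁ boundary

  few : Few s
  few = proj₁ (proj₂ boundary)

  ¬few[1+s] : ¬ Few (suc s)
  ¬few[1+s] = proj₂ (proj₂ boundary)

  private instance
    nˢ≢0 : NonZero (n ^ s)
    nˢ≢0 = m^n≢0 n s

  s*s≤n*v : s * s ≤ n * v
  s*s≤n*v = ≤-trans (*-monoʳ-≤ s (m≤n+m s n)) (*-cancelˡ-≤ (n ^ s) (begin
    n ^ s * (s * (n + s))      ≡⟨ x∙yz≈y∙xz (n ^ s) s (n + s) ⟩
    s * (n ^ s * (n + s))      ≤⟨ *-monoʳ-≤ s (n^s*[n+s]≤n*[1+n]^s n s) ⟩
    s * (n * suc n ^ s)        ≡⟨ x∙yz≈y∙xz s n (suc n ^ s) ⟩
    n * (s * suc n ^ s)        ≤⟨ *-monoʳ-≤ n few ⟩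
    n * (v * n ^ s)            ≡⟨ x∙yz≈z∙xy n v (n ^ s) ⟩
    n ^ s * (n * v)            ∎))
    where open ≤-Reasoning

  100n≤v : 100 * n ≤ v
  100n≤v = *-cancelˡ-≤ 4 (begin
    4 * (100 * n)     ≡⟨ *-assoc 4 100 n ⟨
    400 * n           ≤⟨ *-monoˡ-≤ n (≤-trans (≤ᵇ⇒≤ 400 (5 * 240) _) (*-monoʳ-≤ 5 240≤k)) ⟩
    5 * k * n         ≡⟨ *-comm (5 * k) n ⟩
    n * (5 * k)       ≤⟨ n*5k≤4v ⟩
    4 * v             ∎)
    where open ≤-Reasoning

  10s≤v : 10 * s ≤ v
  10s≤v = ^-cancelˡ-≤ 2 (begin
    (10 * s) ^ 2      ≡⟨ solve 1 (λ s → (con 10 :* s) :^ 2 := con 100 :* (s :* s)) refl s ⟩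
    100 * (s * s)     ≤⟨ *-monoʳ-≤ 100 s*s≤n*v ⟩
    100 * (n * v)     ≡⟨ *-assoc 100 n v ⟨
    100 * n * v       ≤⟨ *-monoˡ-≤ v 100n≤v ⟩
    v * v             ≡⟨ solve 1 (λ v → v :* v := v :^ 2) refl v ⟩
    v ^ 2             ∎)
    where open ≤-Reasoning

  room : suc n * k + s ≤ v
  room = *-cancelˡ-≤ 10 (begin
    10 * (suc n * k + s)
      ≡⟨ solve 3 (λ n k s → con 10 :* ((con 1 :+ n) :* k :+ s) := con 2 :* (n :* (con 5 :* k)) :+ con 10 :* k :+ con 10 :* s)
               refl n k s ⟩
    2 * (n * (5 * k)) + 10 * k + 10 * s ≤⟨ +-mono-≤ (+-mono-≤ (*-monoʳ-≤ 2 n*5k≤4v) 10k≤v) 10s≤v ⟩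
    2 * (4 * v) + v + v                 ≡⟨ solve 1 (λ v → con 2 :* (con 4 :* v) :+ v :+ v := con 10 :* v) refl v ⟩
    10 * v                              ∎)
    where
    open ≤-Reasoning
    10k≤v : 10 * k ≤ v
    10k≤v = ≤-trans (*-monoˡ-≤ k (≤ᵇ⇒≤ 10 13 _)) 13k≤v

  q : ℕ
  q = s / n

  s≡s%n+q*n : s ≡ s % n + q * n
  s≡s%n+q*n = m≡m%n+[m/n]*n s n

  q*n*2^q≤v : q * n * 2 ^ q ≤ v
  q*n*2^q≤v = ≤-trans (*-monoˡ-≤ (2 ^ q) (≤-trans (m≤n+m (q * n) (s % n)) (≤-reflexive (sym s≡s%n+q*n))))
                      (*-cancelʳ-≤ (s * 2 ^ q) v (n ^ s) (begin
    s * 2 ^ q * n ^ s       ≡⟨ *-assoc s (2 ^ q) (n ^ s) ⟩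
    s * (2 ^ q * n ^ s)     ≤⟨ *-monoʳ-≤ s 2^q*n^s≤[1+n]^s ⟩
    s * suc n ^ s           ≤⟨ few ⟩
    v * n ^ s               ∎))
    where
    open ≤-Reasoning
    2^q*n^s≤[1+n]^s : 2 ^ q * n ^ s ≤ suc n ^ s
    2^q*n^s≤[1+n]^s = subst (λ i → 2 ^ q * n ^ i ≤ suc n ^ i) (sym s≡s%n+q*n) (2^q*n^[r+q*n]≤[1+n]^[r+q*n] n q (s % n))

  1+s≤[1+q]*n : suc s ≤ suc q * n
  1+s≤[1+q]*n = begin
    suc s                  ≡⟨ cong suc s≡s%n+q*n ⟩
    suc (s % n) + q * n    ≤⟨ +-monoˡ-≤ (q * n) (m%n<n s n) ⟩
    n + q * n              ∎
    where open ≤-Reasoning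

  k²*[[1+s]*[1+n]]³≤[v*n]³ : k ^ 2 * (suc s * suc n) ^ 3 ≤ (v * n) ^ 3
  k²*[[1+s]*[1+n]]³≤[v*n]³ = *-cancelʳ-≤ (k ^ 2 * (suc s * suc n) ^ 3) ((v * n) ^ 3) 64 (begin
    k ^ 2 * (suc s * suc n) ^ 3 * 64
      ≤⟨ *-monoˡ-≤ 64 (*-monoʳ-≤ (k ^ 2) (^-monoˡ-≤ 3 (*-monoˡ-≤ (suc n) 1+s≤[1+q]*n))) ⟩
    k ^ 2 * (suc q * n * suc n) ^ 3 * 64
      ≡⟨ solve 4 (λ k Q n m → k :^ 2 :* (Q :* n :* m) :^ 3 :* con 64 := k :^ 2 :* n :^ 3 :* (Q :^ 3 :* m :^ 3 :* con 64))
               refl k (suc q) n (suc n) ⟩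
    k ^ 2 * n ^ 3 * (suc q ^ 3 * suc n ^ 3 * 64)
      ≤⟨ *-monoʳ-≤ (k ^ 2 * n ^ 3) ([1+q]^3*[1+n]^3*64≤125*k*n^3 q n k v 10≤n 240≤k q*n*2^q≤v 4v<[1+n]*5k) ⟩
    k ^ 2 * n ^ 3 * (125 * k * n ^ 3)
      ≡⟨ solve 2 (λ k n → k :^ 2 :* n :^ 3 :* (con 125 :* k :* n :^ 3) := (n :* (con 5 :* k)) :^ 3 :* n :^ 3) refl k n ⟩
    (n * (5 * k)) ^ 3 * n ^ 3          ≤⟨ *-monoˡ-≤ (n ^ 3) (^-monoˡ-≤ 3 n*5k≤4v) ⟩
    (4 * v) ^ 3 * n ^ 3                ≡⟨ solve 2 (λ v n → (con 4 :* v) :^ 3 :* n :^ 3 := (v :* n) :^ 3 :* con 64) refl v n ⟩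
    (v * n) ^ 3 * 64                   ∎)
    where open ≤-Reasoning

  k²*nˢ³≤[1+n]ˢ³ : k ^ 2 * (n ^ s) ^ 3 ≤ (suc n ^ s) ^ 3
  k²*nˢ³≤[1+n]ˢ³ = <⇒≤ (*-cancelʳ-< (c ^ 3) (k ^ 2 * b ^ 3) (a ^ 3) (begin-strict
    k ^ 2 * b ^ 3 * c ^ 3     ≡⟨ xy∙z≈xz∙y (k ^ 2) (b ^ 3) (c ^ 3) ⟩
    k ^ 2 * c ^ 3 * b ^ 3     ≤⟨ *-monoˡ-≤ (b ^ 3) k²*[[1+s]*[1+n]]³≤[v*n]³ ⟩
    (v * n) ^ 3 * b ^ 3       ≡⟨ ^-distrib-* (v * n) b 3 ⟨
    (v * n * b) ^ 3           <⟨ ^-monoˡ-< 3 vnb<ca ⟩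
    (c * a) ^ 3               ≡⟨ ^-distrib-* c a 3 ⟩
    c ^ 3 * a ^ 3             ≡⟨ *-comm (c ^ 3) (a ^ 3) ⟩
    a ^ 3 * c ^ 3             ∎))
    where
    open ≤-Reasoning
    a b c : ℕ
    a = suc n ^ s
    b = n ^ s
    c = suc s * suc n
    vnb<ca : v * n * b < c * a
    vnb<ca = begin-strict
      v * n * b               ≡⟨ *-assoc v n b ⟩
      v * n ^ suc s           <⟨ ≰⇒> ¬few[1+s] ⟩
      suc s * suc n ^ suc s   ≡⟨ *-assoc (suc s) (suc n) a ⟨
      c * a                   ∎

  kᵏ*nᴺ≤[1+n]ᴺ : k ^ k * n ^ (n * (2 * lam * s)) ≤ suc n ^ (n * (2 * lam * s))
  kᵏ*nᴺ≤[1+n]ᴺ = subst₂ (λ x y → k ^ k * x ≤ y) (exponent n) (exponent (suc n))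
    (c²b³≤a³⇒cᵏbᵉ≤aᵉ k (2 * lam * n) t k²*nˢ³≤[1+n]ˢ³ (^-monoˡ-≤ s (n≤1+n n)) 3k+t≡2e)
    where
    t : ℕ
    t = proj₁ (m≤n⇒∃[o]m+o≡n 3k≤4λn)
    3k+t≡2e : 3 * k + t ≡ 2 * (2 * lam * n)
    3k+t≡2e = trans (proj₂ (m≤n⇒∃[o]m+o≡n 3k≤4λn)) (solve 2 (λ l n → con 4 :* l :* n := con 2 :* (con 2 :* l :* n)) refl lam n)
    exponent : ∀ x → (x ^ s) ^ (2 * lam * n) ≡ x ^ (n * (2 * lam * s))
    exponent x = trans (^-*-assoc x s (2 * lam * n))
                       (cong (x ^_) (solve 3 (λ s l n → s :* (con 2 :* l :* n) := n :* (con 2 :* l :* s)) refl s lam n))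

k^k≤e⁰ : ∀ k → k < 2 → LeExp (k ^ k) 0
k^k≤e⁰ zero    _ = 0 , ≤-refl
k^k≤e⁰ (suc zero) _ = 0 , ≤-refl
k^k≤e⁰ (suc (suc k)) (s≤s (s≤s ()))

proposition4p1 : (v k lam : ℕ) (B : Blocks v) → IsSIS v k lam B →
    LeExp (k ^ (64 * lam)) k →
    Σ (Subset v) λ X → Σ (Subset v) λ Y →
      IncidenceFree B X Y × ∣ X ∣ ≡ ∣ Y ∣ × LeExp (k ^ k) (2 * lam * ∣ X ∣)
proposition4p1 v k lam B sis k^[64λ]≤eᵏ with 2 ≤? k
... | no  2≰k = ⊥ , ⊥ , (λ p b p∈⊥ → contradiction p∈⊥ ∉⊥) , refl ,
                subst (λ x → LeExp (k ^ k) (2 * lam * x)) (sym (∣⊥∣≡0 v))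
                      (subst (LeExp (k ^ k)) (sym (*-zeroʳ (2 * lam))) (k^k≤e⁰ k (≰⇒> 2≰k)))
... | yes 2≤k =
  let X , Y , free , ∣X∣≡s , ∣Y∣≡s = incidence-free-pair B (≤-trans (s≤s z≤n) 2≤k) (λ b → ≤-reflexive (blockSize b)) n s room few
  in  X , Y , free , trans ∣X∣≡s (sym ∣Y∣≡s) ,
      subst (λ x → LeExp (k ^ k) (2 * lam * x)) (sym ∣X∣≡s) (LeExp-intro (k ^ k) n (2 * lam * s) kᵏ*nᴺ≤[1+n]ᴺ)
  where
  open IsSIS sis
  open Incidence using (incidence-free-pair)
  240≤k′ : 240 ≤ k
  240≤k′ = 240≤k lam≥1 k^[64λ]≤eᵏ 2≤k
  open Parameters {v} lam≥1 240≤k′ (64λ≤k lam≥1 k^[64λ]≤eᵏ (≤-trans (≤ᵇ⇒≤ 3 240 _) 240≤k′))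
                  (k*k+λ≤k+v*λ sis (proj₁ pairAttain))
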